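{- Let $n \geq 1$. The map $\Psi_n$ (defined in the context) is a bijection from the set of strong compositions of $n$ to the set of subsets of $[n-1]=\{1,\ldots,n-1\}$, and whenever $\Psi_n(\alpha) = I$ we have \[ n-\ell(\alpha) = |I|, \qquad 2b(\alpha) - \binom{\ell(\alpha)}{2} + \operatorname{coinv}(\alpha) = \binom{n}{2} - \operatorname{Sum}(I). \] Consequently, \[ \sum_{\alpha \vDash n} z^{n-\ell(\alpha)} q^{2b(\alpha) - \binom{\ell(\alpha)}{2} + \operatorname{coinv}(\alpha)} = \sum_{I \subseteq [n-1]} z^{|I|} q^{\binom{n}{2} - \operatorname{Sum}(I)}. \]
   Context: A strong composition $\alpha \vDash n$ is a sequence $(\alpha_1,\ldots,\alpha_r)$ of positive integers with sum $n$; $\ell(\alpha)=r$ is its length. $\operatorname{coinv}(\alpha) = \#\{1 \le i<j\le \ell(\alpha) : \alpha_i<\alpha_j\}$. If $\mu=(\mu_1\ge \mu_2\ge\cdots)$ is the weakly decreasing rearrangement of $\alpha$, then $b(\alpha) = \sum_i (i-1)\mu_i$. For $I \subseteq [n-1]$, $\operatorname{Sum}(I)=\sum_{i\in I} i$. The map $\Psi_n$: draw $\alpha$ as a left-justified diagram whose $i$-th row from the top has $\alpha_i$ cells. For $t\ge 1$ let $m_t$ be the number of cells in columns $1,\ldots,t$. For each $t = 1,2,\ldots$: list the rows having a cell in column $t$ (i.e. rows $i$ with $\alpha_i \ge t$) from top to bottom as $r_1<r_2<\cdots<r_p$; for each $q$ with $\alpha_{r_q}\ge t+1$, write the number $m_t-(q-1)$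 in the cell of row $r_q$, column $t+1$ (rows with $\alpha_{r_q}=t$ are skipped, but their number $m_t-(q-1)$ is not used). Then $\Psi_n(\alpha)$ is the set of all numbers written in columns $2,3,\ldots$. (Example: $\Psi_{11}(1,3,2,1,3,1)=\{2,4,5,7,9\}$.) -}

module Defs where

open import Data.Bool using (Bool; true; false; if_then_else_)
open import Data.Nat using (ℕ; zero; suc; _+_; _*_; _∸_; _^_; _≤_; _<_; _⊓_; _≤ᵇ_; _<ᵇ_; _≡ᵇ_)
open import Data.Nat.ListAction using (sum)
open import Data.Bool.ListAction using (any)
open import Data.List using (List; []; _∷_; length; map; filter; concatMap; upTo; _++_; concat; foldr)
open import Data.List.Relation.Unary.All using (All)
open import Data.Vec using (Vec; []; _∷_; tabulate; toList; zip; allFin)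
open import Data.Fin using (Fin; toℕ)
open import Data.Fin.Subset using (Subset)
open import Relation.Binary.PropositionalEquality using (_≡_)

IsComp : ℕ → List ℕ → Set
IsComp n α = All (λ a → 1 ≤ a) α × sum α ≡ n
  where open import Data.Product using (_×_)

-- length ℓ(α) is Data.List.length.

coinv : List ℕ → ℕ
coinv []       = 0
coinv (a ∷ as) = length (filter (λ b → a Data.Nat.<? b) as) + coinv as
  where import Data.Nat

insertDesc : ℕ → List ℕ → List ℕ
insertDesc x []       = x ∷ []
insertDesc x (y ∷ ys) = if y ≤ᵇ x then x ∷ y ∷ ys else y ∷ insertDesc x ys

sortDesc : List ℕ → List ℕ
sortDesc []       = []
sortDesc (x ∷ xs) = insertDesc x (sortDesc xs)

weighted : ℕ → List ℕ → ℕ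
weighted k []       = 0
weighted k (m ∷ ms) = k * m + weighted (suc k) ms

b : List ℕ → ℕ
b α = weighted 0 (sortDesc α)

-- m_t = number of cells in columns 1..t = Σ_i min(α_i, t)
cellsUpTo : ℕ → List ℕ → ℕ
cellsUpTo t α = sum (map (λ a → a ⊓ t) α)

-- rows having a cell in column t, top to bottom (their lengths)
rowsAt : ℕ → List ℕ → List ℕ
rowsAt t α = filter (λ a → t Data.Nat.≤? a) α
  where import Data.Nat

-- numbers written into column t+1: row r_q (q = index from 0 here, i.e. q-1)
-- receives m_t - (q-1) if α_{r_q} ≥ t+1.
writeCol : ℕ → ℕ → ℕ → List ℕ → List ℕ
writeCol t m q []       = []
writeCol t m q (a ∷ as) =
  (if suc t ≤ᵇ a then (m ∸ q) ∷ [] else []) ++ writeCol t m (suc q) as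

numbersInColumnAfter : ℕ → List ℕ → List ℕ
numbersInColumnAfter t α = writeCol t (cellsUpTo t α) 0 (rowsAt t α)

-- all numbers written in columns 2,3,...  (t ranges over 1..sum α,
-- which covers every column of the diagram)
psiList : List ℕ → List ℕ
psiList α = concatMap (λ t → numbersInColumnAfter (suc t) α) (upTo (sum α))

-- Ψ_n(α) as a subset of [n-1]; position i : Fin (n-1) stands for i+1.
Ψ : (n : ℕ) → List ℕ → Subset (n ∸ 1)
Ψ n α = tabulate (λ i → any (λ x → suc (toℕ i) ≡ᵇ x) (psiList α))

SumSet : ∀ {m} → Subset m → ℕ
SumSet {m} I = sum (toList (Data.Vec.zipWith (λ i x → if x then suc (toℕ i) else 0) (allFin m) I))
  where import Data.Vec

listsOf : ℕ → ℕ → List (List ℕ)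
listsOf k zero    = [] ∷ []
listsOf k (suc ℓ) = concatMap (λ a → map (suc a ∷_) (listsOf k ℓ)) (upTo k)

compositions : ℕ → List (List ℕ)
compositions n = filter (λ α → sum α Data.Nat.≟ n)
                        (concatMap (listsOf n) (upTo (suc n)))
  where import Data.Nat

allSubsets : (m : ℕ) → List (Subset m)
allSubsets zero    = [] ∷ []
allSubsets (suc m) = map (false ∷_) (allSubsets m) ++ map (true ∷_) (allSubsets m)

-- Label the cells of the diagram of α column by column, each column from its bottom cell
-- to its top cell, by 1, …, n.  The cells of column t then carry m_{t-1}+1, …, m_t, and the
-- number Ψ_n writes to the right of a cell is exactly that cell's label.  Hence Ψ_n(α) is the
-- set of positions of true in the binary word (word n α) recording, cell by cell in this
-- order, whether the row continues; its last letter, for the top cell of the last column, is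
-- false.  This word is the reversed first-column pattern of α followed by the word of α with
-- its first column removed, and the first block can be cut off again because its length, the
-- number of rows, is the number of falses of the whole word.  So α ↦ word n α is a bijection
-- onto the words of length n ending in false, i.e. onto the subsets of [n-1].  The statistics
-- follow by induction on the columns: n − ℓ(α) counts the trues, and
-- 2b(α) + coinv(α) + Sum(I) = C(n,2) + C(ℓ,2), using b(α) = Σ_{i<j} min(α_i, α_j), to which
-- the first column contributes C(ℓ,2).

module Submission where

open import Defs
open import Data.Bool using (Bool; true; false; _∨_; _∧_; if_then_else_; T)
open import Data.Bool.Properties using (∨-identityʳ; ∨-assoc; ∨-comm; ∧-zeroʳ)
open import Data.Bool.ListAction using (any)
open import Data.Nat using (ℕ; zero; suc; _+_; _*_; _∸_; _^_; _≤_; _<_; _≥_; _⊓_; _≤ᵇ_; _<ᵇ_; _≡ᵇ_; z≤n; s≤s; _<?_; _≟_)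
open import Data.Nat.Properties
open import Algebra.Properties.CommutativeSemigroup +-commutativeSemigroup using (x∙yz≈y∙xz; xy∙z≈xz∙y)
open import Data.Nat.ListAction using (sum)
open import Data.Nat.ListAction.Properties using (sum-↭)
open import Data.Nat.Combinatorics using (_C_; nCk+nC[k+1]≡[n+1]C[k+1]; nC1≡n)
open import Data.Nat.Tactic.RingSolver using (solve-∀)
open import Data.List using (List; []; _∷_; _++_; _∷ʳ_; [_]; length; map; reverse; filter; concatMap; upTo; applyUpTo; take; drop)
import Data.List.Properties as List
open import Data.List.Relation.Unary.All using (All; []; _∷_)
import Data.List.Relation.Unary.All as All
import Data.List.Relation.Unary.All.Properties as All
open import Data.List.Relation.Unary.AllPairs using (AllPairs; []; _∷_)
import Data.List.Relation.Unary.AllPairs as AllPairs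
import Data.List.Relation.Unary.AllPairs.Properties as AllPairs
open import Data.List.Relation.Unary.Any using (here; satisfied)
open import Data.List.Relation.Unary.Unique.Propositional using (Unique)
import Data.List.Relation.Unary.Unique.Propositional.Properties as Unique
open import Data.List.Membership.Propositional using (_∈_; lose)
open import Data.List.Membership.Propositional.Properties
  using (∈-map⁺; ∈-map⁻; ∈-++⁺ˡ; ∈-++⁺ʳ; ∈-filter⁺; ∈-filter⁻; ∈-concatMap⁺; ∈-concatMap⁻; ∈-applyUpTo⁺)
open import Data.List.Membership.Propositional.Properties.WithK using (unique∧set⇒bag)
open import Data.List.Relation.Binary.Permutation.Propositional as ↭ using (_↭_; ↭-sym)
import Data.List.Relation.Binary.Permutation.Propositional.Properties as Perm
open import Data.List.Relation.Binary.BagAndSetEquality using (∼bag⇒↭)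
open import Data.Vec using ([]; _∷_; tabulate; toList; zipWith)
import Data.Vec.Properties as Vec
open import Data.Fin using (Fin; toℕ)
import Data.Fin as Fin
open import Data.Fin.Subset using (Subset; ∣_∣)
open import Data.Product using (_×_; ∃; _,_; proj₁; proj₂)
open import Data.Sum using (_⊎_; inj₁; inj₂)
open import Function using (_∘_)
open import Function.Bundles using (mk⇔)
open import Relation.Nullary using (¬_; yes; no; contradiction)
open import Relation.Binary.PropositionalEquality
  using (_≡_; _≢_; refl; sym; trans; cong; cong₂; subst; module ≡-Reasoning)

ones : List Bool → ℕ
ones []          = 0
ones (true ∷ w)  = suc (ones w)
ones (false ∷ w) = ones w

zeros : List Bool → ℕ
zeros []          = 0
zeros (true ∷ w)  = zeros w
zeros (false ∷ w) = suc (zeros w)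

bitAt : List Bool → ℕ → Bool
bitAt []      _       = false
bitAt (x ∷ w) zero    = x
bitAt (x ∷ w) (suc j) = bitAt w j

ones-++ : ∀ u v → ones (u ++ v) ≡ ones u + ones v
ones-++ []          v = refl
ones-++ (true ∷ u)  v = cong suc (ones-++ u v)
ones-++ (false ∷ u) v = ones-++ u v

zeros-++ : ∀ u v → zeros (u ++ v) ≡ zeros u + zeros v
zeros-++ []          v = refl
zeros-++ (true ∷ u)  v = zeros-++ u v
zeros-++ (false ∷ u) v = cong suc (zeros-++ u v)

ones+zeros≡length : ∀ w → ones w + zeros w ≡ length w
ones+zeros≡length []          = refl
ones+zeros≡length (true ∷ w)  = cong suc (ones+zeros≡length w)
ones+zeros≡length (false ∷ w) = trans (+-suc (ones w) (zeros w)) (cong suc (ones+zeros≡length w))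

zeros≤length : ∀ w → zeros w ≤ length w
zeros≤length w = ≤-trans (m≤n+m (zeros w) (ones w)) (≤-reflexive (ones+zeros≡length w))

length-∷ʳ-false : ∀ u → length (u ∷ʳ false) ≡ suc (length u)
length-∷ʳ-false u = trans (List.length-++ u) (+-comm (length u) 1)

module _ (count : List Bool → ℕ) (count-++ : ∀ u v → count (u ++ v) ≡ count u + count v) where

  additive-reverse : ∀ w → count (reverse w) ≡ count w
  additive-reverse []      = refl
  additive-reverse (x ∷ w) = begin
    count (reverse (x ∷ w))      ≡⟨ cong count (List.unfold-reverse x w) ⟩
    count (reverse w ++ [ x ])   ≡⟨ count-++ (reverse w) [ x ] ⟩
    count (reverse w) + count [ x ] ≡⟨ cong (_+ count [ x ]) (additive-reverse w) ⟩
    count w + count [ x ]        ≡⟨ +-comm (count w) _ ⟩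
    count [ x ] + count w        ≡⟨ count-++ [ x ] w ⟨
    count (x ∷ w)                ∎
    where open ≡-Reasoning

ones-reverse : ∀ w → ones (reverse w) ≡ ones w
ones-reverse = additive-reverse ones ones-++

zeros-reverse : ∀ w → zeros (reverse w) ≡ zeros w
zeros-reverse = additive-reverse zeros zeros-++

bitAt-++ˡ : ∀ u v {j} → j < length u → bitAt (u ++ v) j ≡ bitAt u j
bitAt-++ˡ (x ∷ u) v {zero}  _         = refl
bitAt-++ˡ (x ∷ u) v {suc j} (s≤s j<u) = bitAt-++ˡ u v j<u

bitAt-++ʳ : ∀ u v d → bitAt (u ++ v) (length u + d) ≡ bitAt v d
bitAt-++ʳ []      v d = refl
bitAt-++ʳ (x ∷ u) v d = bitAt-++ʳ u v d

bitAt-≥length : ∀ w {j} → length w ≤ j → bitAt w j ≡ false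
bitAt-≥length []      _           = refl
bitAt-≥length (x ∷ w) (s≤s w≤j) = bitAt-≥length w w≤j

bitAt-∷ʳ : ∀ w x j → bitAt (w ∷ʳ x) j ≡ bitAt w j ∨ (x ∧ (j ≡ᵇ length w))
bitAt-∷ʳ []      true  zero    = refl
bitAt-∷ʳ []      false zero    = refl
bitAt-∷ʳ []      true  (suc j) = refl
bitAt-∷ʳ []      false (suc j) = refl
bitAt-∷ʳ (y ∷ w) x     zero    = sym (trans (cong (y ∨_) (∧-zeroʳ x)) (∨-identityʳ y))
bitAt-∷ʳ (y ∷ w) x     (suc j) = bitAt-∷ʳ w x j

sumPositions : ℕ → List Bool → ℕ
sumPositions k []      = 0
sumPositions k (x ∷ w) = (if x then suc k else 0) + sumPositions (suc k) w

sumPositions-++ : ∀ k u w → sumPositions k (u ++ w) ≡ sumPositions k u + sumPositions (k + length u) w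
sumPositions-++ k []      w = cong (λ m → sumPositions m w) (sym (+-identityʳ k))
sumPositions-++ k (x ∷ u) w rewrite sumPositions-++ (suc k) u w | +-suc k (length u) =
  sym (+-assoc (if x then suc k else 0) _ _)

sumPositions-shift : ∀ k w → sumPositions k w ≡ k * ones w + sumPositions 0 w
sumPositions-shift k []          = sym (cong (_+ 0) (*-zeroʳ k))
sumPositions-shift k (true ∷ w)  rewrite sumPositions-shift (suc k) w | sumPositions-shift 1 w =
  rearrange k (ones w) (sumPositions 0 w)
  where
  rearrange : ∀ k c s → suc k + (c + k * c + s) ≡ k * suc c + (1 + (c + 0 + s))
  rearrange = solve-∀
sumPositions-shift k (false ∷ w) rewrite sumPositions-shift (suc k) w | sumPositions-shift 1 w =
  rearrange k (ones w) (sumPositions 0 w)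
  where
  rearrange : ∀ k c s → c + k * c + s ≡ k * c + (c + 0 + s)
  rearrange = solve-∀

Positive : List ℕ → Set
Positive = All (1 ≤_)

continues : ℕ → Bool
continues (suc (suc _)) = true
continues _             = false

dropColumn : List ℕ → List ℕ
dropColumn []                 = []
dropColumn (zero ∷ α)         = dropColumn α
dropColumn (suc zero ∷ α)     = dropColumn α
dropColumn (suc (suc a) ∷ α)  = suc a ∷ dropColumn α

columnWord : List ℕ → List Bool
columnWord α = reverse (map continues α)

-- The fuel f only needs to exceed the number of columns; the lemmas assume sum α ≤ f.
word : ℕ → List ℕ → List Bool
word zero    _ = []
word (suc f) α = columnWord α ++ word f (dropColumn α)

length-columnWord : ∀ α → length (columnWord α) ≡ length α
length-columnWord α = trans (List.length-reverse (map continues α)) (List.length-map continues α)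

word-[] : ∀ f → word f [] ≡ []
word-[] zero    = refl
word-[] (suc f) = word-[] f

dropColumn-positive : ∀ α → Positive (dropColumn α)
dropColumn-positive []                = []
dropColumn-positive (zero ∷ α)        = dropColumn-positive α
dropColumn-positive (suc zero ∷ α)    = dropColumn-positive α
dropColumn-positive (suc (suc a) ∷ α) = s≤s z≤n ∷ dropColumn-positive α

sum-dropColumn : ∀ α → Positive α → sum α ≡ length α + sum (dropColumn α)
sum-dropColumn []                _       = refl
sum-dropColumn (suc zero ∷ α)    (_ ∷ p) = cong suc (sum-dropColumn α p)
sum-dropColumn (suc (suc a) ∷ α) (_ ∷ p) =
  cong suc (trans (cong (suc a +_) (sum-dropColumn α p)) (x∙yz≈y∙xz (suc a) (length α) _))

sum-dropColumn-≤ : ∀ {f} α → Positive α → sum α ≤ suc f → sum (dropColumn α) ≤ f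
sum-dropColumn-≤ []      _ _ = z≤n
sum-dropColumn-≤ (a ∷ α) p α≤ = ≤-pred (begin
  suc (sum (dropColumn (a ∷ α)))                ≤⟨ s≤s (m≤n+m _ (length α)) ⟩
  length (a ∷ α) + sum (dropColumn (a ∷ α))     ≡⟨ sum-dropColumn (a ∷ α) p ⟨
  sum (a ∷ α)                                   ≤⟨ α≤ ⟩
  _                                             ∎)
  where open ≤-Reasoning

positive-sum≤0 : ∀ α → Positive α → sum α ≤ 0 → α ≡ []
positive-sum≤0 []          _        _ = refl
positive-sum≤0 (zero ∷ α)  (() ∷ _) _
positive-sum≤0 (suc a ∷ α) _ ()

ones-map-continues : ∀ α → ones (map continues α) ≡ length (dropColumn α)
ones-map-continues []                = refl
ones-map-continues (zero ∷ α)        = ones-map-continues α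
ones-map-continues (suc zero ∷ α)    = ones-map-continues α
ones-map-continues (suc (suc a) ∷ α) = cong suc (ones-map-continues α)

zeros-map-continues : ∀ α → zeros (map continues α) + length (dropColumn α) ≡ length α
zeros-map-continues []                = refl
zeros-map-continues (zero ∷ α)        = cong suc (zeros-map-continues α)
zeros-map-continues (suc zero ∷ α)    = cong suc (zeros-map-continues α)
zeros-map-continues (suc (suc a) ∷ α) = trans (+-suc _ _) (cong suc (zeros-map-continues α))

length-word : ∀ f α → Positive α → sum α ≤ f → length (word f α) ≡ sum α
length-word zero    α p α≤ rewrite positive-sum≤0 α p α≤ = refl
length-word (suc f) α p α≤ = begin
  length (columnWord α ++ word f (dropColumn α))
    ≡⟨ List.length-++ (columnWord α) ⟩
  length (columnWord α) + length (word f (dropColumn α))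
    ≡⟨ cong₂ _+_ (length-columnWord α) (length-word f (dropColumn α) (dropColumn-positive α) (sum-dropColumn-≤ α p α≤)) ⟩
  length α + sum (dropColumn α)
    ≡⟨ sum-dropColumn α p ⟨
  sum α ∎
  where open ≡-Reasoning

zeros-word : ∀ f α → Positive α → sum α ≤ f → zeros (word f α) ≡ length α
zeros-word zero    α p α≤ rewrite positive-sum≤0 α p α≤ = refl
zeros-word (suc f) α p α≤ = begin
  zeros (columnWord α ++ word f (dropColumn α))
    ≡⟨ zeros-++ (columnWord α) _ ⟩
  zeros (columnWord α) + zeros (word f (dropColumn α))
    ≡⟨ cong₂ _+_ (zeros-reverse (map continues α)) (zeros-word f (dropColumn α) (dropColumn-positive α) (sum-dropColumn-≤ α p α≤)) ⟩
  zeros (map continues α) + length (dropColumn α)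
    ≡⟨ zeros-map-continues α ⟩
  length α ∎
  where open ≡-Reasoning

ones-word : ∀ f α → Positive α → sum α ≤ f → ones (word f α) + length α ≡ sum α
ones-word f α p α≤ = begin
  ones (word f α) + length α          ≡⟨ cong (ones (word f α) +_) (zeros-word f α p α≤) ⟨
  ones (word f α) + zeros (word f α)  ≡⟨ ones+zeros≡length (word f α) ⟩
  length (word f α)                   ≡⟨ length-word f α p α≤ ⟩
  sum α                               ∎
  where open ≡-Reasoning

occurs : ℕ → List ℕ → Bool
occurs y = any (y ≡ᵇ_)

occurs-++ : ∀ y xs ys → occurs y (xs ++ ys) ≡ occurs y xs ∨ occurs y ys
occurs-++ y []       ys = refl
occurs-++ y (x ∷ xs) ys = trans (cong ((y ≡ᵇ x) ∨_) (occurs-++ y xs ys)) (sym (∨-assoc (y ≡ᵇ x) _ _))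

<⊎∃+≡ : ∀ ℓ j → j < ℓ ⊎ ∃ λ d → ℓ + d ≡ j
<⊎∃+≡ ℓ j with j <? ℓ
... | yes j<ℓ = inj₁ j<ℓ
... | no  j≮ℓ = inj₂ (m≤n⇒∃[o]m+o≡n (≮⇒≥ j≮ℓ))

<⇒≡ᵇ-false : ∀ {m n} → m < n → (m ≡ᵇ n) ≡ false
<⇒≡ᵇ-false {zero}  {suc n} _         = refl
<⇒≡ᵇ-false {suc m} {suc n} (s≤s m<n) = <⇒≡ᵇ-false m<n

occurs-map-+-< : ∀ ℓ {j} xs → Positive xs → j < ℓ → occurs (suc j) (map (ℓ +_) xs) ≡ false
occurs-map-+-< ℓ []       _          _   = refl
occurs-map-+-< ℓ (x ∷ xs) (1≤x ∷ ps) j<ℓ =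
  cong₂ _∨_ (<⇒≡ᵇ-false (≤-trans (s≤s j<ℓ) (subst (_≤ ℓ + x) (+-comm ℓ 1) (+-monoʳ-≤ ℓ 1≤x))))
            (occurs-map-+-< ℓ xs ps j<ℓ)

occurs-map-+ : ∀ ℓ d xs → occurs (suc (ℓ + d)) (map (ℓ +_) xs) ≡ occurs (suc d) xs
occurs-map-+ ℓ d []       = refl
occurs-map-+ ℓ d (x ∷ xs) = cong₂ _∨_ (shift ℓ) (occurs-map-+ ℓ d xs)
  where
  shift : ∀ ℓ → (suc (ℓ + d) ≡ᵇ ℓ + x) ≡ (suc d ≡ᵇ x)
  shift zero    = refl
  shift (suc ℓ) = shift ℓ

anyUpTo : ℕ → (ℕ → Bool) → Bool
anyUpTo zero    g = false
anyUpTo (suc K) g = g 0 ∨ anyUpTo K (g ∘ suc)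

anyUpTo-false : ∀ K {g} → (∀ t → g t ≡ false) → anyUpTo K g ≡ false
anyUpTo-false zero    g≡false = refl
anyUpTo-false (suc K) g≡false = cong₂ _∨_ (g≡false 0) (anyUpTo-false K (g≡false ∘ suc))

anyUpTo-cong : ∀ K {g h} → (∀ t → g t ≡ h t) → anyUpTo K g ≡ anyUpTo K h
anyUpTo-cong zero    g≗h = refl
anyUpTo-cong (suc K) g≗h = cong₂ _∨_ (g≗h 0) (anyUpTo-cong K (g≗h ∘ suc))

occurs-concatMap-applyUpTo : ∀ y (F : ℕ → List ℕ) K h →
  occurs y (concatMap F (applyUpTo h K)) ≡ anyUpTo K (λ t → occurs y (F (h t)))
occurs-concatMap-applyUpTo y F zero    h = refl
occurs-concatMap-applyUpTo y F (suc K) h =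
  trans (occurs-++ y (F (h 0)) _) (cong (occurs y (F (h 0)) ∨_) (occurs-concatMap-applyUpTo y F K (h ∘ suc)))

occurs-writeCol-1 : ∀ as q j → occurs (suc j) (writeCol 1 (q + length as) q as) ≡ bitAt (columnWord as) j
occurs-writeCol-1 []       q j = refl
occurs-writeCol-1 (a ∷ as) q j = begin
  occurs (suc j) (writeCol 1 (q + suc L) q (a ∷ as))
    ≡⟨ occurs-++ (suc j) (if 2 ≤ᵇ a then [ q + suc L ∸ q ] else []) _ ⟩
  occurs (suc j) (if 2 ≤ᵇ a then [ q + suc L ∸ q ] else []) ∨ occurs (suc j) (writeCol 1 (q + suc L) (suc q) as)
    ≡⟨ cong₂ _∨_ (trans (occurs-if a {suc j}) (cong (λ v → continues a ∧ (suc j ≡ᵇ v)) (m+n∸m≡n q (suc L))))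
                 (trans (cong (λ m → occurs (suc j) (writeCol 1 m (suc q) as)) (+-suc q L)) (occurs-writeCol-1 as (suc q) j)) ⟩
  (continues a ∧ (j ≡ᵇ L)) ∨ bitAt (columnWord as) j
    ≡⟨ ∨-comm (continues a ∧ (j ≡ᵇ L)) _ ⟩
  bitAt (columnWord as) j ∨ (continues a ∧ (j ≡ᵇ L))
    ≡⟨ cong (λ m → bitAt (columnWord as) j ∨ (continues a ∧ (j ≡ᵇ m))) (length-columnWord as) ⟨
  bitAt (columnWord as) j ∨ (continues a ∧ (j ≡ᵇ length (columnWord as)))
    ≡⟨ bitAt-∷ʳ (columnWord as) (continues a) j ⟨
  bitAt (columnWord as ∷ʳ continues a) j
    ≡⟨ cong (λ w → bitAt w j) (List.unfold-reverse (continues a) (map continues as)) ⟨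
  bitAt (columnWord (a ∷ as)) j ∎
  where
  open ≡-Reasoning
  L = length as
  occurs-if : ∀ a {y v} → occurs y (if 2 ≤ᵇ a then [ v ] else []) ≡ continues a ∧ (y ≡ᵇ v)
  occurs-if zero          = refl
  occurs-if (suc zero)    = refl
  occurs-if (suc (suc a)) = ∨-identityʳ _

rowsAt-1 : ∀ β → Positive β → rowsAt 1 β ≡ β
rowsAt-1 []          _       = refl
rowsAt-1 (suc a ∷ β) (_ ∷ p) = cong (suc a ∷_) (rowsAt-1 β p)

cellsUpTo-1 : ∀ β → Positive β → cellsUpTo 1 β ≡ length β
cellsUpTo-1 []          _       = refl
cellsUpTo-1 (suc a ∷ β) (_ ∷ p) = cong suc (trans (cong (_+ cellsUpTo 1 β) (⊓-zeroʳ a)) (cellsUpTo-1 β p))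

numbersInColumnAfter-1 : ∀ β → Positive β → numbersInColumnAfter 1 β ≡ writeCol 1 (0 + length β) 0 β
numbersInColumnAfter-1 β p rewrite rowsAt-1 β p | cellsUpTo-1 β p = refl

rowsAt-dropColumn : ∀ t β → Positive β → rowsAt (2 + t) β ≡ map suc (rowsAt (suc t) (dropColumn β))
rowsAt-dropColumn t []                _       = refl
rowsAt-dropColumn t (suc zero ∷ β)    (_ ∷ p) = rowsAt-dropColumn t β p
rowsAt-dropColumn t (suc (suc a) ∷ β) (_ ∷ p) with t <ᵇ suc a
... | true  = cong (suc (suc a) ∷_) (rowsAt-dropColumn t β p)
... | false = rowsAt-dropColumn t β p

cellsUpTo-dropColumn : ∀ t β → Positive β → cellsUpTo (2 + t) β ≡ length β + cellsUpTo (suc t) (dropColumn β)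
cellsUpTo-dropColumn t []                _       = refl
cellsUpTo-dropColumn t (suc zero ∷ β)    (_ ∷ p) = cong suc (cellsUpTo-dropColumn t β p)
cellsUpTo-dropColumn t (suc (suc a) ∷ β) (_ ∷ p) =
  cong suc (trans (cong (suc (a ⊓ t) +_) (cellsUpTo-dropColumn t β p)) (x∙yz≈y∙xz (suc (a ⊓ t)) (length β) _))

length-rowsAt≤cellsUpTo : ∀ t β → length (rowsAt (suc t) β) ≤ cellsUpTo (suc t) β
length-rowsAt≤cellsUpTo t []          = z≤n
length-rowsAt≤cellsUpTo t (zero ∷ β)  = length-rowsAt≤cellsUpTo t β
length-rowsAt≤cellsUpTo t (suc a ∷ β) with t <ᵇ suc a
... | true  = s≤s (≤-trans (length-rowsAt≤cellsUpTo t β) (m≤n+m _ (a ⊓ t)))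
... | false = ≤-trans (length-rowsAt≤cellsUpTo t β) (m≤n+m _ (suc (a ⊓ t)))

writeCol-map-suc : ∀ t ℓ m q rows → q + length rows ≤ m →
  writeCol (2 + t) (ℓ + m) q (map suc rows) ≡ map (ℓ +_) (writeCol (suc t) m q rows)
writeCol-map-suc t ℓ m q []         _ = refl
writeCol-map-suc t ℓ m q (a ∷ rows) q+rows≤m with suc t <ᵇ a
... | true  = cong₂ _∷_ (+-∸-assoc ℓ (≤-trans (m≤m+n q _) q+rows≤m))
                        (writeCol-map-suc t ℓ m (suc q) rows (subst (_≤ m) (+-suc q _) q+rows≤m))
... | false = writeCol-map-suc t ℓ m (suc q) rows (subst (_≤ m) (+-suc q _) q+rows≤m)

writeCol-positive : ∀ t m q rows → q + length rows ≤ m → Positive (writeCol t m q rows)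
writeCol-positive t m q []         _ = []
writeCol-positive t m q (a ∷ rows) q+rows≤m with suc t ≤ᵇ a
... | true  = m<n⇒0<n∸m (≤-trans (s≤s (m≤m+n q _)) q+rows≤m') ∷ writeCol-positive t m (suc q) rows q+rows≤m'
  where q+rows≤m' = subst (_≤ m) (+-suc q _) q+rows≤m
... | false = writeCol-positive t m (suc q) rows (subst (_≤ m) (+-suc q _) q+rows≤m)

numbersInColumnAfter-positive : ∀ t β → Positive (numbersInColumnAfter (suc t) β)
numbersInColumnAfter-positive t β =
  writeCol-positive (suc t) (cellsUpTo (suc t) β) 0 (rowsAt (suc t) β) (length-rowsAt≤cellsUpTo t β)

numbersInColumnAfter-dropColumn : ∀ t β → Positive β →
  numbersInColumnAfter (2 + t) β ≡ map (length β +_) (numbersInColumnAfter (suc t) (dropColumn β))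
numbersInColumnAfter-dropColumn t β p rewrite rowsAt-dropColumn t β p | cellsUpTo-dropColumn t β p =
  writeCol-map-suc t (length β) (cellsUpTo (suc t) (dropColumn β)) 0 (rowsAt (suc t) (dropColumn β))
                   (length-rowsAt≤cellsUpTo t (dropColumn β))

occursInColumns≡bitAt-word : ∀ f β → Positive β → sum β ≤ f → ∀ j →
  anyUpTo f (λ t → occurs (suc j) (numbersInColumnAfter (suc t) β)) ≡ bitAt (word f β) j
occursInColumns≡bitAt-word f       []          _ _ j =
  trans (anyUpTo-false f (λ _ → refl)) (cong (λ w → bitAt w j) (sym (word-[] f)))
occursInColumns≡bitAt-word zero    (zero ∷ β)  (() ∷ _) _ j
occursInColumns≡bitAt-word zero    (suc a ∷ β) _ () j
occursInColumns≡bitAt-word (suc f) β@(_ ∷ _)   p β≤ j = cases (<⊎∃+≡ ℓ j)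
  where
  open ≡-Reasoning
  ℓ  = length β
  β' = dropColumn β
  first : occurs (suc j) (numbersInColumnAfter 1 β) ≡ bitAt (columnWord β) j
  first = trans (cong (occurs (suc j)) (numbersInColumnAfter-1 β p)) (occurs-writeCol-1 β 0 j)
  later : ∀ t → occurs (suc j) (numbersInColumnAfter (2 + t) β)
              ≡ occurs (suc j) (map (ℓ +_) (numbersInColumnAfter (suc t) β'))
  later t = cong (occurs (suc j)) (numbersInColumnAfter-dropColumn t β p)
  cases : j < ℓ ⊎ ∃ (λ d → ℓ + d ≡ j) →
    occurs (suc j) (numbersInColumnAfter 1 β) ∨ anyUpTo f (λ t → occurs (suc j) (numbersInColumnAfter (2 + t) β))
      ≡ bitAt (columnWord β ++ word f β') j
  cases (inj₁ j<ℓ) = begin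
    _ ≡⟨ cong₂ _∨_ first (anyUpTo-false f (λ t → trans (later t)
                     (occurs-map-+-< ℓ _ (numbersInColumnAfter-positive t β') j<ℓ))) ⟩
    bitAt (columnWord β) j ∨ false ≡⟨ ∨-identityʳ _ ⟩
    bitAt (columnWord β) j         ≡⟨ bitAt-++ˡ (columnWord β) _ (subst (j <_) (sym (length-columnWord β)) j<ℓ) ⟨
    bitAt (columnWord β ++ word f β') j ∎
  cases (inj₂ (d , refl)) = begin
    _ ≡⟨ cong₂ _∨_ (trans first (bitAt-≥length (columnWord β) (≤-trans (≤-reflexive (length-columnWord β)) (m≤m+n ℓ d))))
                   (anyUpTo-cong f (λ t → trans (later t) (occurs-map-+ ℓ d (numbersInColumnAfter (suc t) β')))) ⟩
    anyUpTo f (λ t → occurs (suc d) (numbersInColumnAfter (suc t) β'))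
      ≡⟨ occursInColumns≡bitAt-word f β' (dropColumn-positive β) (sum-dropColumn-≤ β p β≤) d ⟩
    bitAt (word f β') d
      ≡⟨ bitAt-++ʳ (columnWord β) (word f β') d ⟨
    bitAt (columnWord β ++ word f β') (length (columnWord β) + d)
      ≡⟨ cong (λ m → bitAt (columnWord β ++ word f β') (m + d)) (length-columnWord β) ⟩
    bitAt (columnWord β ++ word f β') (ℓ + d) ∎

EndsInFalse : List Bool → Set
EndsInFalse w = w ≡ [] ⊎ ∃ λ u → w ≡ u ∷ʳ false

EndsInFalse-++ : ∀ u {v} → EndsInFalse v → ¬ v ≡ [] → EndsInFalse (u ++ v)
EndsInFalse-++ u (inj₁ v≡[])         v≢[] = contradiction v≡[] v≢[]
EndsInFalse-++ u (inj₂ (v' , refl)) _    = inj₂ (u ++ v' , sym (List.++-assoc u v' [ false ]))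

EndsInFalse-drop : ∀ k u → k ≤ suc (length u) → EndsInFalse (drop k (u ∷ʳ false))
EndsInFalse-drop zero          u       _         = inj₂ (u , refl)
EndsInFalse-drop (suc zero)    []      _         = inj₁ refl
EndsInFalse-drop (suc (suc k)) []      (s≤s ())
EndsInFalse-drop (suc k)       (x ∷ u) (s≤s k≤u) = EndsInFalse-drop k u k≤u

columnWord-EndsInFalse : ∀ α → dropColumn α ≡ [] → EndsInFalse (columnWord α)
columnWord-EndsInFalse []             _ = inj₁ refl
columnWord-EndsInFalse (zero ∷ α)     _ = inj₂ (columnWord α , List.unfold-reverse false (map continues α))
columnWord-EndsInFalse (suc zero ∷ α) _ = inj₂ (columnWord α , List.unfold-reverse false (map continues α))

word-EndsInFalse : ∀ f α → Positive α → sum α ≤ f → EndsInFalse (word f α)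
word-EndsInFalse zero    α p α≤ = inj₁ refl
word-EndsInFalse (suc f) α p α≤ with dropColumn α in eq
... | [] rewrite word-[] f | List.++-identityʳ (columnWord α) = columnWord-EndsInFalse α eq
... | a ∷ α' with dropColumn-positive α | sum-dropColumn-≤ α p α≤
...   | p' | α'≤ rewrite eq = EndsInFalse-++ (columnWord α) (word-EndsInFalse f (a ∷ α') p' α'≤) nonempty
  where
  nonempty : ¬ word f (a ∷ α') ≡ []
  nonempty w≡[] = <⇒≢ (≤-trans (All.head p') (m≤m+n a (sum α')))
                      (sym (trans (sym (length-word f (a ∷ α') p' α'≤)) (cong length w≡[])))

addColumn : List Bool → List ℕ → List ℕ
addColumn []          _        = []
addColumn (false ∷ v) α        = 1 ∷ addColumn v α
addColumn (true ∷ v)  []       = 2 ∷ addColumn v []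
addColumn (true ∷ v)  (a ∷ α)  = suc a ∷ addColumn v α

addColumn-dropColumn : ∀ α → Positive α → addColumn (map continues α) (dropColumn α) ≡ α
addColumn-dropColumn []                _       = refl
addColumn-dropColumn (suc zero ∷ α)    (_ ∷ p) = cong (1 ∷_) (addColumn-dropColumn α p)
addColumn-dropColumn (suc (suc a) ∷ α) (_ ∷ p) = cong (suc (suc a) ∷_) (addColumn-dropColumn α p)

addColumn-positive : ∀ v α → Positive (addColumn v α)
addColumn-positive []          α       = []
addColumn-positive (false ∷ v) α       = s≤s z≤n ∷ addColumn-positive v α
addColumn-positive (true ∷ v)  []      = s≤s z≤n ∷ addColumn-positive v []
addColumn-positive (true ∷ v)  (a ∷ α) = s≤s z≤n ∷ addColumn-positive v α

map-continues-addColumn : ∀ v α → Positive α → map continues (addColumn v α) ≡ v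
map-continues-addColumn []          α           _       = refl
map-continues-addColumn (false ∷ v) α           p       = cong (false ∷_) (map-continues-addColumn v α p)
map-continues-addColumn (true ∷ v)  []          p       = cong (true ∷_) (map-continues-addColumn v [] p)
map-continues-addColumn (true ∷ v)  (suc a ∷ α) (_ ∷ p) = cong (true ∷_) (map-continues-addColumn v α p)

dropColumn-addColumn : ∀ v α → Positive α → ones v ≡ length α → dropColumn (addColumn v α) ≡ α
dropColumn-addColumn []          []          _       _ = refl
dropColumn-addColumn (false ∷ v) α           p       e = dropColumn-addColumn v α p e
dropColumn-addColumn (true ∷ v)  (suc a ∷ α) (_ ∷ p) e = cong (suc a ∷_) (dropColumn-addColumn v α p (suc-injective e))

sum-addColumn : ∀ v α → ones v ≡ length α → sum (addColumn v α) ≡ length v + sum α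
sum-addColumn []          []      _ = refl
sum-addColumn (false ∷ v) α       e = cong suc (sum-addColumn v α e)
sum-addColumn (true ∷ v)  (a ∷ α) e = cong suc (trans (cong (a +_) (sum-addColumn v α (suc-injective e))) (x∙yz≈y∙xz a (length v) (sum α)))

word-addColumn : ∀ f v α → Positive α → ones v ≡ length α → word (suc f) (addColumn v α) ≡ reverse v ++ word f α
word-addColumn f v α p e =
  cong₂ (λ u β → reverse u ++ word f β) (map-continues-addColumn v α p) (dropColumn-addColumn v α p e)

-- A word has one false per row, so zeros w is the length of its first block.
decode : ℕ → List Bool → List ℕ
decode zero    w = []
decode (suc f) w = addColumn (reverse (take (zeros w) w)) (decode f (drop (zeros w) w))

decode-positive : ∀ f w → Positive (decode f w)
decode-positive zero    w = []
decode-positive (suc f) w = addColumn-positive _ _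

take-length-++ : ∀ (u v : List Bool) → take (length u) (u ++ v) ≡ u
take-length-++ []      v = refl
take-length-++ (x ∷ u) v = cong (x ∷_) (take-length-++ u v)

drop-length-++ : ∀ (u v : List Bool) → drop (length u) (u ++ v) ≡ v
drop-length-++ []      v = refl
drop-length-++ (x ∷ u) v = drop-length-++ u v

decode-word : ∀ f α → Positive α → sum α ≤ f → decode f (word f α) ≡ α
decode-word zero    α p α≤ = sym (positive-sum≤0 α p α≤)
decode-word (suc f) α p α≤ = begin
  decode (suc f) (columnWord α ++ W)
    ≡⟨ cong (λ k → addColumn (reverse (take k (columnWord α ++ W))) (decode f (drop k (columnWord α ++ W)))) zeros≡ ⟩
  addColumn (reverse (take (length (columnWord α)) (columnWord α ++ W))) (decode f (drop (length (columnWord α)) (columnWord α ++ W)))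
    ≡⟨ cong₂ addColumn (trans (cong reverse (take-length-++ (columnWord α) W)) (List.reverse-involutive (map continues α)))
                       (trans (cong (decode f) (drop-length-++ (columnWord α) W))
                              (decode-word f (dropColumn α) (dropColumn-positive α) (sum-dropColumn-≤ α p α≤))) ⟩
  addColumn (map continues α) (dropColumn α)
    ≡⟨ addColumn-dropColumn α p ⟩
  α ∎
  where
  open ≡-Reasoning
  W = word f (dropColumn α)
  zeros≡ : zeros (columnWord α ++ W) ≡ length (columnWord α)
  zeros≡ = trans (zeros-word (suc f) α p α≤) (sym (length-columnWord α))

word-decode : ∀ f w → length w ≤ f → EndsInFalse w → sum (decode f w) ≡ length w × word f (decode f w) ≡ w
word-decode zero    w           _  (inj₁ refl)       = refl , refl
word-decode (suc f) w           _  (inj₁ refl)       = refl , word-[] (suc f)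
word-decode zero    w           w≤ (inj₂ (u , refl)) = contradiction (subst (_≤ 0) (length-∷ʳ-false u) w≤) λ ()
word-decode (suc f) w           w≤ (inj₂ (u , refl)) = sum≡ , word≡
  where
  open ≡-Reasoning
  z      = zeros w
  column = take z w
  rest   = drop z w
  z≤w : z ≤ length w
  z≤w = zeros≤length w
  1≤z : 1 ≤ z
  1≤z = ≤-trans (m≤n+m 1 (zeros u)) (≤-reflexive (sym (zeros-++ u [ false ])))
  rest≤ : length rest ≤ f
  rest≤ = ≤-trans (≤-reflexive (List.length-drop z w)) (≤-trans (∸-monoʳ-≤ (length w) 1≤z) (∸-monoˡ-≤ 1 w≤))
  IH = word-decode f rest rest≤ (EndsInFalse-drop z u (subst (z ≤_) (length-∷ʳ-false u) z≤w))
  α' = decode f rest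
  length-column+rest : length column + length rest ≡ length w
  length-column+rest = trans (sym (List.length-++ column)) (cong length (List.take++drop≡id z w))
  ones-column : ones (reverse column) ≡ length α'
  ones-column = begin
    ones (reverse column) ≡⟨ ones-reverse column ⟩
    ones column           ≡⟨ +-cancelʳ-≡ (zeros column) _ _ (begin
      ones column + zeros column  ≡⟨ ones+zeros≡length column ⟩
      length column               ≡⟨ trans (List.length-take z w) (m≤n⇒m⊓n≡m z≤w) ⟩
      z                           ≡⟨ trans (sym (zeros-++ column rest)) (cong zeros (List.take++drop≡id z w)) ⟨
      zeros column + zeros rest   ≡⟨ +-comm (zeros column) _ ⟩
      zeros rest + zeros column   ∎) ⟩
    zeros rest            ≡⟨ cong zeros (proj₂ IH) ⟨
    zeros (word f α')     ≡⟨ zeros-word f α' (decode-positive f rest) (subst (_≤ f) (sym (proj₁ IH)) rest≤) ⟩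
    length α'             ∎
  sum≡ : sum (addColumn (reverse column) α') ≡ length w
  sum≡ = begin
    sum (addColumn (reverse column) α') ≡⟨ sum-addColumn (reverse column) α' ones-column ⟩
    length (reverse column) + sum α'    ≡⟨ cong₂ _+_ (List.length-reverse column) (proj₁ IH) ⟩
    length column + length rest         ≡⟨ length-column+rest ⟩
    length w                            ∎
  word≡ : word (suc f) (addColumn (reverse column) α') ≡ w
  word≡ = begin
    word (suc f) (addColumn (reverse column) α') ≡⟨ word-addColumn f (reverse column) α' (decode-positive f rest) ones-column ⟩
    reverse (reverse column) ++ word f α'        ≡⟨ cong₂ _++_ (List.reverse-involutive column) (proj₂ IH) ⟩
    column ++ rest                               ≡⟨ List.take++drop≡id z w ⟩
    w                                            ∎

toSubset : ∀ {m} → List Bool → Subset m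
toSubset w = tabulate (bitAt w ∘ toℕ)

toSubset-toList-++ : ∀ {m} (I : Subset m) w → toSubset (toList I ++ w) ≡ I
toSubset-toList-++ []      w = refl
toSubset-toList-++ (x ∷ I) w = cong (x ∷_) (toSubset-toList-++ I w)

toList-toSubset-++ : ∀ {m} u w → length u ≡ m → toList (toSubset {m} (u ++ w)) ≡ u
toList-toSubset-++ []      w refl = refl
toList-toSubset-++ (x ∷ u) w refl = cong (x ∷_) (toList-toSubset-++ u w refl)

∣∣≡ones-toList : ∀ {m} (I : Subset m) → ∣ I ∣ ≡ ones (toList I)
∣∣≡ones-toList []          = refl
∣∣≡ones-toList (true ∷ I)  = cong suc (∣∣≡ones-toList I)
∣∣≡ones-toList (false ∷ I) = ∣∣≡ones-toList I

SumSet≡sumPositions : ∀ {m} (I : Subset m) → SumSet I ≡ sumPositions 0 (toList I)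
SumSet≡sumPositions I = go 0 I (λ i → i) (λ i → refl)
  where
  go : ∀ {m k} c (I : Subset m) (F : Fin m → Fin k) → (∀ i → toℕ (F i) ≡ c + toℕ i) →
    sum (toList (zipWith (λ i x → if x then suc (toℕ i) else 0) (tabulate F) I)) ≡ sumPositions c (toList I)
  go c []      F F≡ = refl
  go c (x ∷ I) F F≡ = cong₂ _+_ (head x) (go (suc c) I (F ∘ Fin.suc) (λ i → trans (F≡ (Fin.suc i)) (+-suc c (toℕ i))))
    where
    head : ∀ x → (if x then suc (toℕ (F Fin.zero)) else 0) ≡ (if x then suc c else 0)
    head true  = cong suc (trans (F≡ Fin.zero) (+-identityʳ c))
    head false = refl

Ψ≡toSubset-word : ∀ n α → IsComp n α → Ψ n α ≡ toSubset (word n α)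
Ψ≡toSubset-word n α (p , refl) = Vec.tabulate-cong λ i →
  trans (occurs-concatMap-applyUpTo (suc (toℕ i)) (λ t → numbersInColumnAfter (suc t) α) (sum α) (λ t → t))
        (occursInColumns≡bitAt-word (sum α) α p ≤-refl (toℕ i))

word≡toList-Ψ : ∀ n α → 1 ≤ n → IsComp n α → word n α ≡ toList (Ψ n α) ∷ʳ false
word≡toList-Ψ n α 1≤n c@(p , refl) with word-EndsInFalse n α p ≤-refl
... | inj₁ w≡[] = contradiction (trans (sym (length-word n α p ≤-refl)) (cong length w≡[])) (>⇒≢ 1≤n)
... | inj₂ (u , w≡u0) = begin
  word n α                                     ≡⟨ w≡u0 ⟩
  u ∷ʳ false                                   ≡⟨ cong (_∷ʳ false) (toList-toSubset-++ u [ false ] length-u) ⟨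
  toList (toSubset {n ∸ 1} (u ∷ʳ false)) ∷ʳ false ≡⟨ cong (λ w → toList (toSubset {n ∸ 1} w) ∷ʳ false) w≡u0 ⟨
  toList (toSubset {n ∸ 1} (word n α)) ∷ʳ false ≡⟨ cong (λ I → toList I ∷ʳ false) (Ψ≡toSubset-word n α c) ⟨
  toList (Ψ n α) ∷ʳ false                      ∎
  where
  open ≡-Reasoning
  length-u : length u ≡ n ∸ 1
  length-u = trans (sym (m+n∸n≡m (length u) 1))
                   (cong (_∸ 1) (trans (sym (List.length-++ u)) (trans (cong length (sym w≡u0)) (length-word n α p ≤-refl))))

suc-C2 : ∀ n → suc n C 2 ≡ n + n C 2
suc-C2 n = trans (sym (nCk+nC[k+1]≡[n+1]C[k+1] n 1)) (cong (_+ n C 2) (nC1≡n n))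

+-C2 : ∀ a c → (a + c) C 2 ≡ a C 2 + a * c + c C 2
+-C2 zero    c = refl
+-C2 (suc a) c = begin
  suc (a + c) C 2                    ≡⟨ suc-C2 (a + c) ⟩
  a + c + (a + c) C 2                ≡⟨ cong (a + c +_) (+-C2 a c) ⟩
  a + c + (a C 2 + a * c + c C 2)    ≡⟨ rearrange a c (a C 2) (c C 2) ⟩
  a + a C 2 + (c + a * c) + c C 2    ≡⟨ cong (λ x → x + (c + a * c) + c C 2) (suc-C2 a) ⟨
  suc a C 2 + suc a * c + c C 2      ∎
  where
  open ≡-Reasoning
  rearrange : ∀ a c x y → a + c + (x + a * c + y) ≡ a + x + (c + a * c) + y
  rearrange = solve-∀

+≡+⇒∸+≡∸ : ∀ {x y s N c} → c ≤ x → x + y + s ≡ N + c → x ∸ c + y ≡ N ∸ s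
+≡+⇒∸+≡∸ {x} {y} {s} {N} {c} c≤x x+y+s≡N+c = begin
  x ∸ c + y           ≡⟨ +-∸-comm y c≤x ⟨
  x + y ∸ c           ≡⟨ m+n∸n≡m (x + y ∸ c) s ⟨
  x + y ∸ c + s ∸ s   ≡⟨ cong (_∸ s) (+-cancelʳ-≡ c _ _ (begin
    x + y ∸ c + s + c ≡⟨ xy∙z≈xz∙y (x + y ∸ c) s c ⟩
    x + y ∸ c + c + s ≡⟨ cong (_+ s) (m∸n+n≡m (≤-trans c≤x (m≤m+n x y))) ⟩
    x + y + s         ≡⟨ x+y+s≡N+c ⟩
    N + c             ∎)) ⟩
  N ∸ s               ∎
  where open ≡-Reasoning

falseTruePairs : List Bool → ℕ
falseTruePairs []          = 0
falseTruePairs (false ∷ v) = ones v + falseTruePairs v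
falseTruePairs (true ∷ v)  = falseTruePairs v

-- A one at index i of v sits at position length v − i of reverse v, and
-- i = (zeros before it) + (ones before it).
falseTruePairs+sumPositions-reverse : ∀ v →
  falseTruePairs v + sumPositions 0 (reverse v) + ones v C 2 ≡ length v * ones v
falseTruePairs+sumPositions-reverse []      = refl
falseTruePairs+sumPositions-reverse (x ∷ v)
  rewrite List.unfold-reverse x v | sumPositions-++ 0 (reverse v) [ x ] | List.length-reverse v = step x
  where
  IH = falseTruePairs+sumPositions-reverse v
  L = length v
  step : ∀ x → falseTruePairs (x ∷ v) + (sumPositions 0 (reverse v) + sumPositions L [ x ]) + ones (x ∷ v) C 2
               ≡ suc L * ones (x ∷ v)
  step true  rewrite suc-C2 (ones v) =
    trans (rearrange (falseTruePairs v) (sumPositions 0 (reverse v)) L (ones v) (ones v C 2))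
          (trans (cong (λ m → m + suc L + ones v) IH) (expand L (ones v)))
    where
    rearrange : ∀ x s L k t → x + (s + (suc L + 0)) + (k + t) ≡ (x + s + t) + suc L + k
    rearrange = solve-∀
    expand : ∀ L k → L * k + suc L + k ≡ suc L * suc k
    expand = solve-∀
  step false = trans (rearrange (falseTruePairs v) (sumPositions 0 (reverse v)) (ones v) (ones v C 2))
                     (cong (ones v +_) IH)
    where
    rearrange : ∀ x s k t → k + x + (s + 0) + t ≡ k + (x + s + t)
    rearrange = solve-∀

minSum : ℕ → List ℕ → ℕ
minSum a α = sum (map (a ⊓_) α)

pairMinSum : List ℕ → ℕ
pairMinSum []      = 0
pairMinSum (a ∷ α) = minSum a α + pairMinSum α

minSum-0 : ∀ α → minSum 0 α ≡ 0
minSum-0 []      = refl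
minSum-0 (a ∷ α) = minSum-0 α

minSum-dropColumn : ∀ c α → Positive α → minSum (suc c) α ≡ length α + minSum c (dropColumn α)
minSum-dropColumn c []                _       = refl
minSum-dropColumn c (suc zero ∷ α)    (_ ∷ p) =
  cong suc (trans (cong (_+ minSum (suc c) α) (⊓-zeroʳ c)) (minSum-dropColumn c α p))
minSum-dropColumn c (suc (suc a) ∷ α) (_ ∷ p) rewrite minSum-dropColumn c α p =
  cong suc (x∙yz≈y∙xz (c ⊓ suc a) (length α) (minSum c (dropColumn α)))

pairMinSum-dropColumn : ∀ α → Positive α → pairMinSum α ≡ length α C 2 + pairMinSum (dropColumn α)
pairMinSum-dropColumn [] _ = refl
pairMinSum-dropColumn (suc zero ∷ α) (_ ∷ p)
  rewrite minSum-dropColumn 0 α p | minSum-0 (dropColumn α) | pairMinSum-dropColumn α p | suc-C2 (length α) =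
  rearrange (length α) (length α C 2) (pairMinSum (dropColumn α))
  where
  rearrange : ∀ L t q → L + 0 + (t + q) ≡ L + t + q
  rearrange = solve-∀
pairMinSum-dropColumn (suc (suc a) ∷ α) (_ ∷ p)
  rewrite minSum-dropColumn (suc a) α p | pairMinSum-dropColumn α p | suc-C2 (length α) =
  rearrange (length α) (minSum (suc a) (dropColumn α)) (length α C 2) (pairMinSum (dropColumn α))
  where
  rearrange : ∀ L s t q → L + s + (t + q) ≡ L + t + (s + q)
  rearrange = solve-∀

pairMinSum-↭ : ∀ {α β} → α ↭ β → pairMinSum α ≡ pairMinSum β
pairMinSum-↭ ↭.refl                       = refl
pairMinSum-↭ (↭.prep a p)                 = cong₂ _+_ (sum-↭ (Perm.map⁺ (a ⊓_) p)) (pairMinSum-↭ p)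
pairMinSum-↭ (↭.swap {α} {β} a c p)       = begin
  a ⊓ c + minSum a α + (minSum c α + pairMinSum α)
    ≡⟨ cong₂ (λ m s → m + minSum a α + (minSum c α + s)) (⊓-comm a c) (pairMinSum-↭ p) ⟩
  c ⊓ a + minSum a α + (minSum c α + pairMinSum β)
    ≡⟨ rearrange (c ⊓ a) (minSum a α) (minSum c α) (pairMinSum β) ⟩
  c ⊓ a + minSum c α + (minSum a α + pairMinSum β)
    ≡⟨ cong₂ (λ x y → c ⊓ a + x + (y + pairMinSum β)) (sum-↭ (Perm.map⁺ (c ⊓_) p)) (sum-↭ (Perm.map⁺ (a ⊓_) p)) ⟩
  c ⊓ a + minSum c β + (minSum a β + pairMinSum β) ∎
  where
  open ≡-Reasoning
  rearrange : ∀ m x y z → m + x + (y + z) ≡ m + y + (x + z)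
  rearrange = solve-∀
pairMinSum-↭ (↭.trans p q)                = trans (pairMinSum-↭ p) (pairMinSum-↭ q)

insertDesc-↭ : ∀ x ys → insertDesc x ys ↭ x ∷ ys
insertDesc-↭ x []       = ↭.refl
insertDesc-↭ x (y ∷ ys) with y ≤ᵇ x
... | true  = ↭.refl
... | false = ↭.trans (↭.prep y (insertDesc-↭ x ys)) (↭.swap y x ↭.refl)

sortDesc-↭ : ∀ xs → sortDesc xs ↭ xs
sortDesc-↭ []       = ↭.refl
sortDesc-↭ (x ∷ xs) = ↭.trans (insertDesc-↭ x (sortDesc xs)) (↭.prep x (sortDesc-↭ xs))

insertDesc-sorted : ∀ x ys → AllPairs _≥_ ys → AllPairs _≥_ (insertDesc x ys)
insertDesc-sorted x []       _                = [] ∷ []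
insertDesc-sorted x (y ∷ ys) (y≥ys ∷ ys-sorted) with y ≤ᵇ x in y≤ᵇx
... | true  = (y≤x ∷ All.map (λ z≤y → ≤-trans z≤y y≤x) y≥ys) ∷ y≥ys ∷ ys-sorted
  where y≤x = ≤ᵇ⇒≤ y x (subst T (sym y≤ᵇx) _)
... | false = Perm.All-resp-↭ (↭-sym (insertDesc-↭ x ys)) (x≤y ∷ y≥ys) ∷ insertDesc-sorted x ys ys-sorted
  where x≤y = <⇒≤ (≰⇒> (λ y≤x → subst T y≤ᵇx (≤⇒≤ᵇ y≤x)))

sortDesc-sorted : ∀ xs → AllPairs _≥_ (sortDesc xs)
sortDesc-sorted []       = []
sortDesc-sorted (x ∷ xs) = insertDesc-sorted x (sortDesc xs) (sortDesc-sorted xs)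

weighted-suc : ∀ k μ → weighted (suc k) μ ≡ sum μ + weighted k μ
weighted-suc k []      = refl
weighted-suc k (m ∷ μ) rewrite weighted-suc (suc k) μ = rearrange m k (sum μ) (weighted (suc k) μ)
  where
  rearrange : ∀ m k s w → m + k * m + (s + w) ≡ m + s + (k * m + w)
  rearrange = solve-∀

minSum-≥ : ∀ m μ → All (m ≥_) μ → minSum m μ ≡ sum μ
minSum-≥ m []      _            = refl
minSum-≥ m (x ∷ μ) (x≤m ∷ μ≤m) = cong₂ _+_ (m≥n⇒m⊓n≡n x≤m) (minSum-≥ m μ μ≤m)

weighted-sorted : ∀ μ → AllPairs _≥_ μ → weighted 0 μ ≡ pairMinSum μ
weighted-sorted []      _                = refl
weighted-sorted (m ∷ μ) (m≥μ ∷ μ-sorted) =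
  trans (weighted-suc 0 μ) (cong₂ _+_ (sym (minSum-≥ m μ m≥μ)) (weighted-sorted μ μ-sorted))

b≡pairMinSum : ∀ α → b α ≡ pairMinSum α
b≡pairMinSum α = trans (weighted-sorted (sortDesc α) (sortDesc-sorted α)) (pairMinSum-↭ (sortDesc-↭ α))

countAbove-1 : ∀ α → Positive α → length (filter (1 <?_) α) ≡ ones (map continues α)
countAbove-1 []                _       = refl
countAbove-1 (suc zero ∷ α)    (_ ∷ p) = countAbove-1 α p
countAbove-1 (suc (suc a) ∷ α) (_ ∷ p) = cong suc (countAbove-1 α p)

countAbove-dropColumn : ∀ k α → Positive α →
  length (filter (2 + k <?_) α) ≡ length (filter (suc k <?_) (dropColumn α))
countAbove-dropColumn k []                _       = refl
countAbove-dropColumn k (suc zero ∷ α)    (_ ∷ p) = countAbove-dropColumn k α p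
countAbove-dropColumn k (suc (suc a) ∷ α) (_ ∷ p) with k <ᵇ a
... | true  = cong suc (countAbove-dropColumn k α p)
... | false = countAbove-dropColumn k α p

coinv-dropColumn : ∀ α → Positive α → coinv α ≡ coinv (dropColumn α) + falseTruePairs (map continues α)
coinv-dropColumn []                _       = refl
coinv-dropColumn (suc zero ∷ α)    (_ ∷ p) rewrite countAbove-1 α p | coinv-dropColumn α p =
  x∙yz≈y∙xz (ones (map continues α)) (coinv (dropColumn α)) _
coinv-dropColumn (suc (suc a) ∷ α) (_ ∷ p) rewrite countAbove-dropColumn a α p | coinv-dropColumn α p =
  sym (+-assoc (length (filter (suc a <?_) (dropColumn α))) (coinv (dropColumn α)) _)

pairMinSum+coinv+sumPositions-word : ∀ f α → Positive α → sum α ≤ f →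
  2 * pairMinSum α + coinv α + sumPositions 0 (word f α) ≡ sum α C 2 + length α C 2
pairMinSum+coinv+sumPositions-word zero    α p α≤ rewrite positive-sum≤0 α p α≤ = refl
pairMinSum+coinv+sumPositions-word (suc f) α p α≤ = begin
  2 * pairMinSum α + coinv α + sumPositions 0 (columnWord α ++ W)
    ≡⟨ cong₂ _+_ (cong₂ _+_ (cong (2 *_) (pairMinSum-dropColumn α p)) (coinv-dropColumn α p)) sumPositions-word ⟩
  2 * (ℓ C 2 + pairMinSum α') + (coinv α' + falseTruePairs v) + (sumPositions 0 (columnWord α) + (ℓ * ones W + sumPositions 0 W))
    ≡⟨ combine (ℓ C 2) (pairMinSum α') (coinv α') (falseTruePairs v) (sumPositions 0 (columnWord α)) (ones W) (sumPositions 0 W)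
               (sum α' C 2) (k C 2) ℓ k IH first-column ⟩
  ℓ C 2 + ℓ * (ones W + k) + sum α' C 2 + ℓ C 2
    ≡⟨ cong (λ m → ℓ C 2 + ℓ * m + sum α' C 2 + ℓ C 2) (ones-word f α' (dropColumn-positive α) α'≤) ⟩
  ℓ C 2 + ℓ * sum α' + sum α' C 2 + ℓ C 2
    ≡⟨ cong (_+ ℓ C 2) (trans (cong (_C 2) (sum-dropColumn α p)) (+-C2 ℓ (sum α'))) ⟨
  sum α C 2 + ℓ C 2 ∎
  where
  open ≡-Reasoning
  ℓ  = length α
  α' = dropColumn α
  v  = map continues α
  k  = length α'
  W  = word f α'
  α'≤ = sum-dropColumn-≤ α p α≤
  IH = pairMinSum+coinv+sumPositions-word f α' (dropColumn-positive α) α'≤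
  sumPositions-word : sumPositions 0 (columnWord α ++ W) ≡ sumPositions 0 (columnWord α) + (ℓ * ones W + sumPositions 0 W)
  sumPositions-word = trans (sumPositions-++ 0 (columnWord α) W)
    (cong (sumPositions 0 (columnWord α) +_) (trans (cong (λ m → sumPositions m W) (length-columnWord α)) (sumPositions-shift ℓ W)))
  first-column : falseTruePairs v + sumPositions 0 (columnWord α) + k C 2 ≡ ℓ * k
  first-column = begin
    falseTruePairs v + sumPositions 0 (columnWord α) + k C 2 ≡⟨ cong (λ m → falseTruePairs v + sumPositions 0 (columnWord α) + m C 2) (ones-map-continues α) ⟨
    falseTruePairs v + sumPositions 0 (reverse v) + ones v C 2 ≡⟨ falseTruePairs+sumPositions-reverse v ⟩
    length v * ones v ≡⟨ cong₂ _*_ (List.length-map continues α) (ones-map-continues α) ⟩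
    ℓ * k ∎
  combine : ∀ T P Cv X Sb c S tn tk ℓ k → 2 * P + Cv + S ≡ tn + tk → X + Sb + tk ≡ ℓ * k →
    2 * (T + P) + (Cv + X) + (Sb + (ℓ * c + S)) ≡ T + ℓ * (c + k) + tn + T
  combine T P Cv X Sb c S tn tk ℓ k rest col = +-cancelʳ-≡ tk _ _ (begin
    2 * (T + P) + (Cv + X) + (Sb + (ℓ * c + S)) + tk ≡⟨ regroup T P Cv X Sb c S tk ℓ ⟩
    (2 * P + Cv + S) + (X + Sb + tk) + 2 * T + ℓ * c  ≡⟨ cong₂ (λ u w → u + w + 2 * T + ℓ * c) rest col ⟩
    tn + tk + ℓ * k + 2 * T + ℓ * c                    ≡⟨ regroup′ T c tn tk ℓ k ⟩
    T + ℓ * (c + k) + tn + T + tk                      ∎)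
    where
    regroup : ∀ T P Cv X Sb c S tk ℓ → 2 * (T + P) + (Cv + X) + (Sb + (ℓ * c + S)) + tk
                                      ≡ (2 * P + Cv + S) + (X + Sb + tk) + 2 * T + ℓ * c
    regroup = solve-∀
    regroup′ : ∀ T c tn tk ℓ k → tn + tk + ℓ * k + 2 * T + ℓ * c ≡ T + ℓ * (c + k) + tn + T + tk
    regroup′ = solve-∀

fromSubset : (n : ℕ) → Subset (n ∸ 1) → List ℕ
fromSubset n I = decode n (toList I ∷ʳ false)

fromSubset-Ψ : ∀ n α → 1 ≤ n → IsComp n α → fromSubset n (Ψ n α) ≡ α
fromSubset-Ψ n α 1≤n c@(p , sum≡n) =
  trans (cong (decode n) (sym (word≡toList-Ψ n α 1≤n c))) (decode-word n α p (≤-reflexive sum≡n))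

Ψ-injective : ∀ n → 1 ≤ n → ∀ α β → IsComp n α → IsComp n β → Ψ n α ≡ Ψ n β → α ≡ β
Ψ-injective n 1≤n α β cα cβ Ψα≡Ψβ =
  trans (sym (fromSubset-Ψ n α 1≤n cα)) (trans (cong (fromSubset n) Ψα≡Ψβ) (fromSubset-Ψ n β 1≤n cβ))

fromSubset-isComp-Ψ : ∀ n → 1 ≤ n → (I : Subset (n ∸ 1)) → IsComp n (fromSubset n I) × Ψ n (fromSubset n I) ≡ I
fromSubset-isComp-Ψ n 1≤n I = isComp , (begin
  Ψ n α                   ≡⟨ Ψ≡toSubset-word n α isComp ⟩
  toSubset (word n α)     ≡⟨ cong toSubset word≡ ⟩
  toSubset (toList I ∷ʳ false) ≡⟨ toSubset-toList-++ I [ false ] ⟩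
  I                       ∎)
  where
  open ≡-Reasoning
  w = toList I ∷ʳ false
  α = fromSubset n I
  length-w : length w ≡ n
  length-w = trans (length-∷ʳ-false (toList I)) (trans (cong suc (Vec.length-toList I)) (m+[n∸m]≡n 1≤n))
  decoded = word-decode n w (≤-reflexive length-w) (inj₂ (toList I , refl))
  word≡ = proj₂ decoded
  isComp : IsComp n α
  isComp = decode-positive n w , trans (proj₁ decoded) length-w

Ψ-statistics : ∀ n α I → 1 ≤ n → IsComp n α → Ψ n α ≡ I →
  (n ∸ length α ≡ ∣ I ∣) × (2 * b α ∸ (length α C 2) + coinv α ≡ (n C 2) ∸ SumSet I)
Ψ-statistics n α I 1≤n c@(p , refl) refl = size , weight
  where
  ℓ = length α
  W = word n α
  W≡ : W ≡ toList I ∷ʳ false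
  W≡ = word≡toList-Ψ n α 1≤n c
  size : n ∸ ℓ ≡ ∣ I ∣
  size = begin
    n ∸ ℓ                    ≡⟨ cong (_∸ ℓ) (ones-word n α p ≤-refl) ⟨
    ones W + ℓ ∸ ℓ           ≡⟨ m+n∸n≡m (ones W) ℓ ⟩
    ones W                   ≡⟨ trans (cong ones W≡) (ones-++ (toList I) [ false ]) ⟩
    ones (toList I) + 0      ≡⟨ +-identityʳ _ ⟩
    ones (toList I)          ≡⟨ ∣∣≡ones-toList I ⟨
    ∣ I ∣                    ∎
    where open ≡-Reasoning
  sumPositions-W : sumPositions 0 W ≡ SumSet I
  sumPositions-W = begin
    sumPositions 0 W                ≡⟨ trans (cong (sumPositions 0) W≡) (sumPositions-++ 0 (toList I) [ false ]) ⟩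
    sumPositions 0 (toList I) + 0   ≡⟨ +-identityʳ _ ⟩
    sumPositions 0 (toList I)       ≡⟨ SumSet≡sumPositions I ⟨
    SumSet I                        ∎
    where open ≡-Reasoning
  ℓC2≤2b : ℓ C 2 ≤ 2 * b α
  ℓC2≤2b = begin
    ℓ C 2                                   ≤⟨ m≤m+n (ℓ C 2) (pairMinSum (dropColumn α)) ⟩
    ℓ C 2 + pairMinSum (dropColumn α)       ≡⟨ trans (b≡pairMinSum α) (pairMinSum-dropColumn α p) ⟨
    b α                                     ≤⟨ m≤m+n (b α) _ ⟩
    2 * b α                                 ∎
    where open ≤-Reasoning
  weight : 2 * b α ∸ ℓ C 2 + coinv α ≡ n C 2 ∸ SumSet I
  weight = +≡+⇒∸+≡∸ ℓC2≤2b (begin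
    2 * b α + coinv α + SumSet I
      ≡⟨ cong₂ (λ m s → 2 * m + coinv α + s) (sym (b≡pairMinSum α)) sumPositions-W ⟨
    2 * pairMinSum α + coinv α + sumPositions 0 W
      ≡⟨ pairMinSum+coinv+sumPositions-word n α p ≤-refl ⟩
    n C 2 + ℓ C 2 ∎)
    where open ≡-Reasoning

∈-allSubsets : ∀ m (I : Subset m) → I ∈ allSubsets m
∈-allSubsets zero    []          = here refl
∈-allSubsets (suc m) (false ∷ I) = ∈-++⁺ˡ (∈-map⁺ (false ∷_) (∈-allSubsets m I))
∈-allSubsets (suc m) (true ∷ I)  = ∈-++⁺ʳ (map (false ∷_) (allSubsets m)) (∈-map⁺ (true ∷_) (∈-allSubsets m I))

allSubsets-unique : ∀ m → Unique (allSubsets m)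
allSubsets-unique zero    = [] ∷ []
allSubsets-unique (suc m) =
  Unique.++⁺ (Unique.map⁺ Vec.∷-injectiveʳ (allSubsets-unique m)) (Unique.map⁺ Vec.∷-injectiveʳ (allSubsets-unique m)) disjoint
  where
  disjoint : ∀ {I} → ¬ (I ∈ map (false ∷_) (allSubsets m) × I ∈ map (true ∷_) (allSubsets m))
  disjoint (I∈₀ , I∈₁) with ∈-map⁻ (false ∷_) I∈₀ | ∈-map⁻ (true ∷_) I∈₁
  ... | _ , _ , refl | _ , _ , ()

∈-listsOf⁻ : ∀ {k} ℓ {xs} → xs ∈ listsOf k ℓ → length xs ≡ ℓ × Positive xs
∈-listsOf⁻ zero    (here refl) = refl , []
∈-listsOf⁻ {k} (suc ℓ) xs∈ with satisfied (∈-concatMap⁻ (λ a → map (suc a ∷_) (listsOf k ℓ)) {xs = upTo k} xs∈)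
... | a , xs∈′ with ∈-map⁻ (suc a ∷_) xs∈′
... | ys , ys∈ , refl = cong suc (proj₁ (∈-listsOf⁻ ℓ ys∈)) , s≤s z≤n ∷ proj₂ (∈-listsOf⁻ ℓ ys∈)

∈-listsOf⁺ : ∀ k xs → All (λ a → 1 ≤ a × a ≤ k) xs → xs ∈ listsOf k (length xs)
∈-listsOf⁺ k []       _                  = here refl
∈-listsOf⁺ k (suc a ∷ xs) ((_ , a<k) ∷ ps) =
  ∈-concatMap⁺ (λ a → map (suc a ∷_) (listsOf k (length xs)))
               (lose (∈-applyUpTo⁺ (λ a → a) a<k) (∈-map⁺ (suc a ∷_) (∈-listsOf⁺ k xs ps)))

listsOf-unique : ∀ k ℓ → Unique (listsOf k ℓ)
listsOf-unique k zero    = [] ∷ []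
listsOf-unique k (suc ℓ) =
  Unique.concat⁺ (All.map⁺ (All.applyUpTo⁺₂ (λ a → a) k (λ a → Unique.map⁺ List.∷-injectiveʳ (listsOf-unique k ℓ))))
                 (AllPairs.map⁺ (AllPairs.map disjoint (Unique.upTo⁺ k)))
  where
  disjoint : ∀ {a c} → a ≢ c → ∀ {xs} → ¬ (xs ∈ map (suc a ∷_) (listsOf k ℓ) × xs ∈ map (suc c ∷_) (listsOf k ℓ))
  disjoint a≢c (xs∈a , xs∈c) with ∈-map⁻ _ xs∈a | ∈-map⁻ _ xs∈c
  ... | _ , _ , refl | _ , _ , e = a≢c (suc-injective (List.∷-injectiveˡ e))

compositions-unique : ∀ n → Unique (compositions n)
compositions-unique n =
  Unique.filter⁺ (λ α → sum α ≟ n)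
    (Unique.concat⁺ (All.map⁺ (All.applyUpTo⁺₂ (λ a → a) (suc n) (listsOf-unique n)))
                    (AllPairs.map⁺ (AllPairs.map disjoint (Unique.upTo⁺ (suc n)))))
  where
  disjoint : ∀ {ℓ ℓ′} → ℓ ≢ ℓ′ → ∀ {α} → ¬ (α ∈ listsOf n ℓ × α ∈ listsOf n ℓ′)
  disjoint ℓ≢ℓ′ (α∈ , α∈′) = ℓ≢ℓ′ (trans (sym (proj₁ (∈-listsOf⁻ _ α∈))) (proj₁ (∈-listsOf⁻ _ α∈′)))

∈-compositions⁻ : ∀ n {α} → α ∈ compositions n → IsComp n α
∈-compositions⁻ n {α} α∈ with ∈-filter⁻ (λ α → sum α ≟ n) {xs = concatMap (listsOf n) (upTo (suc n))} α∈
... | α∈′ , sum≡n with satisfied (∈-concatMap⁻ (listsOf n) {xs = upTo (suc n)} α∈′)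
... | ℓ , α∈ℓ = proj₂ (∈-listsOf⁻ ℓ α∈ℓ) , sum≡n

∈-compositions⁺ : ∀ n {α} → IsComp n α → α ∈ compositions n
∈-compositions⁺ n {α} (p , sum≡n) =
  ∈-filter⁺ (λ α → sum α ≟ n)
    (∈-concatMap⁺ (listsOf n) (lose (∈-applyUpTo⁺ (λ a → a) (s≤s length≤n)) (∈-listsOf⁺ n α bounded)))
    sum≡n
  where
  ≤sum : ∀ xs → All (_≤ sum xs) xs
  ≤sum []       = []
  ≤sum (x ∷ xs) = m≤m+n x (sum xs) ∷ All.map (λ y≤ → ≤-trans y≤ (m≤n+m (sum xs) x)) (≤sum xs)
  length≤sum : ∀ xs → Positive xs → length xs ≤ sum xs
  length≤sum []       _          = z≤n
  length≤sum (x ∷ xs) (1≤x ∷ ps) = +-mono-≤ 1≤x (length≤sum xs ps)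
  length≤n : length α ≤ n
  length≤n = subst (length α ≤_) sum≡n (length≤sum α p)
  bounded : All (λ a → 1 ≤ a × a ≤ n) α
  bounded = All.zip (p , All.map (subst (_ ≤_) sum≡n) (≤sum α))

map-Ψ-compositions-↭ : ∀ n → 1 ≤ n → map (Ψ n) (compositions n) ↭ allSubsets (n ∸ 1)
map-Ψ-compositions-↭ n 1≤n =
  ∼bag⇒↭ (unique∧set⇒bag Ψ-unique (allSubsets-unique (n ∸ 1))
                         (mk⇔ (λ _ → ∈-allSubsets (n ∸ 1) _) ∈-image))
  where
  Ψ-unique : Unique (map (Ψ n) (compositions n))
  Ψ-unique = Unique.map⁻ {f = fromSubset n} (subst Unique (begin
    compositions n                                   ≡⟨ List.map-id-local (All.tabulate (λ α∈ → fromSubset-Ψ n _ 1≤n (∈-compositions⁻ n α∈))) ⟨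
    map (fromSubset n ∘ Ψ n) (compositions n)        ≡⟨ List.map-∘ (compositions n) ⟩
    map (fromSubset n) (map (Ψ n) (compositions n))  ∎) (compositions-unique n))
    where open ≡-Reasoning
  ∈-image : ∀ {I} → I ∈ allSubsets (n ∸ 1) → I ∈ map (Ψ n) (compositions n)
  ∈-image {I} _ = subst (_∈ map (Ψ n) (compositions n)) (proj₂ (fromSubset-isComp-Ψ n 1≤n I))
                        (∈-map⁺ (Ψ n) (∈-compositions⁺ n (proj₁ (fromSubset-isComp-Ψ n 1≤n I))))

generating-function : ∀ n → 1 ≤ n → ∀ z q →
  sum (map (λ α → z ^ (n ∸ length α) * q ^ (2 * b α ∸ (length α C 2) + coinv α)) (compositions n))
  ≡ sum (map (λ I → z ^ ∣ I ∣ * q ^ ((n C 2) ∸ SumSet I)) (allSubsets (n ∸ 1)))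
generating-function n 1≤n z q = begin
  sum (map F (compositions n))             ≡⟨ cong sum (List.map-cong-local (All.tabulate F≡G∘Ψ)) ⟩
  sum (map (G ∘ Ψ n) (compositions n))     ≡⟨ cong sum (List.map-∘ (compositions n)) ⟩
  sum (map G (map (Ψ n) (compositions n))) ≡⟨ sum-↭ (Perm.map⁺ G (map-Ψ-compositions-↭ n 1≤n)) ⟩
  sum (map G (allSubsets (n ∸ 1)))         ∎
  where
  open ≡-Reasoning
  F : List ℕ → ℕ
  F α = z ^ (n ∸ length α) * q ^ (2 * b α ∸ (length α C 2) + coinv α)
  G : Subset (n ∸ 1) → ℕ
  G I = z ^ ∣ I ∣ * q ^ ((n C 2) ∸ SumSet I)
  F≡G∘Ψ : ∀ {α} → α ∈ compositions n → F α ≡ G (Ψ n α)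
  F≡G∘Ψ α∈ = let size , weight = Ψ-statistics n _ _ 1≤n (∈-compositions⁻ n α∈) refl
             in cong₂ (λ e e′ → z ^ e * q ^ e′) size weight

mainTheorem1 : (n : ℕ) → 1 ≤ n →
    -- Ψ_n is injective on strong compositions of n
    ((α β : List ℕ) → IsComp n α → IsComp n β → Ψ n α ≡ Ψ n β → α ≡ β)
    -- Ψ_n is surjective onto the subsets of [n-1]
    × ((I : Subset (n ∸ 1)) → ∃ λ α → IsComp n α × Ψ n α ≡ I)
    -- statistics
    × ((α : List ℕ) (I : Subset (n ∸ 1)) → IsComp n α → Ψ n α ≡ I →
         (n ∸ length α ≡ ∣ I ∣)
         × (2 * b α ∸ (length α C 2) + coinv α ≡ (n C 2) ∸ SumSet I))
    -- generating function identity (as polynomials in z, q with ℕ coefficients,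
    -- stated as equality of evaluations at all z q : ℕ)
    × ((z q : ℕ) →
         sum (map (λ α → z ^ (n ∸ length α) * q ^ (2 * b α ∸ (length α C 2) + coinv α))
                  (compositions n))
         ≡ sum (map (λ I → z ^ ∣ I ∣ * q ^ ((n C 2) ∸ SumSet I)) (allSubsets (n ∸ 1))))
mainTheorem1 n 1≤n =
  Ψ-injective n 1≤n ,
  (λ I → fromSubset n I , fromSubset-isComp-Ψ n 1≤n I) ,
  (λ α I → Ψ-statistics n α I 1≤n) ,
  generating-function n 1≤n
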